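{- For every integer $n\ge 1$, the number of Dumont permutations of the first kind of length $2n$ that avoid the pattern $213$ equals the Catalan number $C_{n-1}=\frac{1}{n}\binom{2n-2}{n-1}$, i.e. $|\mathfrak D^1_{2n}(213)|=C_{n-1}$.
   Context: A permutation $\sigma\in\mathfrak S_m$ contains a pattern $\tau\in\mathfrak S_k$ if $\sigma$ has a subsequence $(\sigma(i_1),\dots,\sigma(i_k))$, $i_1<\dots<i_k$, order-isomorphic to $\tau$; otherwise $\sigma$ avoids $\tau$. A Dumont permutation of the first kind of length $2n$ is a permutation $\pi\in\mathfrak S_{2n}$ such that for every $i$: if $\pi(i)$ is even then $i<2n$ and $\pi(i)>\pi(i+1)$; if $\pi(i)$ is odd then $i=2n$ or $\pi(i)<\pi(i+1)$. $\mathfrak D^1_{2n}(\tau)$ denotes the set of such permutations avoiding $\tau$. -}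

module Defs where

open import Data.Nat using (ℕ; zero; suc; _+_; _∸_)
open import Data.Nat.Divisibility using (_∣_; _∣?_)
open import Data.Fin using (Fin; toℕ; _<_; _>_)
open import Data.Fin.Properties using (_≟_; _<?_; all?; any?)
open import Data.Vec using (Vec; []; _∷_; lookup)
open import Data.List using (List; []; _∷_; concatMap; map; filter; length; allFin)
open import Data.Product using (Σ; ∃; ∃-syntax; _×_; _,_)
open import Data.Sum using (_⊎_)
open import Relation.Nullary using (¬_; Dec)
open import Relation.Nullary.Decidable using (_×-dec_; _⊎-dec_; _→-dec_; ¬?)
open import Relation.Binary.PropositionalEquality using (_≡_)
open import Data.Nat.Properties using () renaming (_≟_ to _≟ℕ_)

-- A word of length k over the alphabet Fin m; a permutation of [m] = {1,…,m}
-- is represented by a word π of length m over Fin m, where the value of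
-- position i (0-based) is  toℕ (lookup π i) + 1  (so values range over 1..m).
Word : ℕ → ℕ → Set
Word m k = Vec (Fin m) k

allWords : (m k : ℕ) → List (Word m k)
allWords m zero    = [] ∷ []
allWords m (suc k) = concatMap (λ x → map (x ∷_) (allWords m k)) (allFin m)

val : ∀ {m} → Word m m → Fin m → ℕ
val π i = suc (toℕ (lookup π i))

-- π is a permutation: injective (hence bijective) as a map Fin m → Fin m
IsPerm : ∀ {m} → Word m m → Set
IsPerm π = ∀ i j → lookup π i ≡ lookup π j → i ≡ j

Contains213 : ∀ {m} → Word m m → Set
Contains213 {m} π = ∃[ i ] ∃[ j ] ∃[ k ]
  (i < j × j < k × lookup π j < lookup π i × lookup π i < lookup π k)

Avoids213 : ∀ {m} → Word m m → Set
Avoids213 π = ¬ Contains213 π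

Even Odd : ℕ → Set
Even v = 2 ∣ v
Odd v = ¬ (2 ∣ v)

Next : ∀ {m} → Fin m → Fin m → Set
Next i j = toℕ j ≡ suc (toℕ i)

Dumont1 : ∀ {m} → Word m m → Set
Dumont1 {m} π = ∀ i →
    (Even (val π i) → ∃[ j ] (Next i j × lookup π i > lookup π j))
  × (Odd (val π i) → (suc (toℕ i) ≡ m) ⊎ ∃[ j ] (Next i j × lookup π i < lookup π j))

isPerm? : ∀ {m} (π : Word m m) → Dec (IsPerm π)
isPerm? π = all? λ i → all? λ j → (lookup π i ≟ lookup π j) →-dec (i ≟ j)

contains213? : ∀ {m} (π : Word m m) → Dec (Contains213 π)
contains213? π = any? λ i → any? λ j → any? λ k →
  (i <? j) ×-dec (j <? k) ×-dec (lookup π j <? lookup π i) ×-dec (lookup π i <? lookup π k)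

dumont1? : ∀ {m} (π : Word m m) → Dec (Dumont1 π)
dumont1? {m} π = all? λ i →
     ((2 ∣? val π i) →-dec (any? λ j → (toℕ j ≟ℕ suc (toℕ i)) ×-dec (lookup π j <? lookup π i)))
  ×-dec
     (¬? (2 ∣? val π i) →-dec ((suc (toℕ i) ≟ℕ m) ⊎-dec
        (any? λ j → (toℕ j ≟ℕ suc (toℕ i)) ×-dec (lookup π i <? lookup π j))))

InD1-213 : ∀ {m} → Word m m → Set
InD1-213 π = IsPerm π × Dumont1 π × Avoids213 π

inD1-213? : ∀ {m} (π : Word m m) → Dec (InD1-213 π)
inD1-213? π = isPerm? π ×-dec dumont1? π ×-dec ¬? (contains213? π)

countD1-213 : ℕ → ℕ
countD1-213 m = length (filter inD1-213? (allWords m m))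

module Submission where

-- Read a permutation in 𝔇¹₂ₙ(213) from right to left. It must end in 2 1, and each further
-- letter is forced to be either the next even value 2(r+1), where 2r is the largest even value
-- placed so far, or the largest odd value below 2r still missing: any other choice breaks the
-- Dumont condition or creates a 213. Placing 2(r+1) makes 2r+1 available and placing an odd
-- value uses the latest available one, so these permutations correspond to ballot sequences with
-- n-1 steps of each kind, which the reflection principle counts as C(2n-2, n-1)/n.

open import Defs
open import Data.Bool using (Bool; true; false; if_then_else_)
open import Data.Empty using (⊥; ⊥-elim)
open import Data.Fin using (Fin; toℕ; fromℕ<; punchOut)
  renaming (zero to fzero; suc to fsuc; _<_ to _<ᶠ_; _>_ to _>ᶠ_)
import Data.Fin.Properties as Fin
open import Data.List
  using (List; []; _∷_; map; _++_; length; drop; filter; allFin; concatMap; cartesianProductWith)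
open import Data.List.Membership.Propositional using (_∈_; _∉_)
open import Data.List.Membership.Propositional.Properties
  using (∈-++⁺ˡ; ∈-++⁺ʳ; ∈-++⁻; ∈-∃++; ∈-map⁺; ∈-map⁻; ∈-allFin; ∈-filter⁺; ∈-filter⁻; ∈-cartesianProductWith⁺)
open import Data.List.Membership.Propositional.Properties.WithK using (unique∧set⇒bag)
open import Data.List.Properties using (length-map; length-++; ++-assoc; ∷-injective; ∷-injectiveˡ; ∷-injectiveʳ)
open import Data.List.Relation.Binary.BagAndSetEquality using (∼bag⇒↭)
open import Data.List.Relation.Binary.Permutation.Propositional.Properties using (↭-length)
open import Data.List.Relation.Unary.All as All using (All; []; _∷_)
import Data.List.Relation.Unary.All.Properties as All
open import Data.List.Relation.Unary.AllPairs as AllPairs using (AllPairs; []; _∷_)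
open import Data.List.Relation.Unary.Any as Any using (Any; here; there)
open import Data.List.Relation.Unary.Unique.Propositional using (Unique)
import Data.List.Relation.Unary.Unique.Propositional.Properties as Unique
open import Data.Nat using (ℕ; zero; suc; _+_; _*_; _∸_; _/_; _≤_; _<_; _>_; z≤n; s≤s; s≤s⁻¹; _≤?_; NonZero)
open import Data.Nat.Combinatorics using (_C_; nCn≡1; nCk+nC[k+1]≡[n+1]C[k+1])
open import Data.Nat.Divisibility using (divides; m∣m*n; _∣?_)
open import Data.Nat.DivMod using (m*n/n≡m)
open import Data.Nat.Properties
open import Data.Nat.Solver using (module +-*-Solver)
open import Data.Product using (∃; ∃₂; ∃-syntax; _×_; _,_; proj₁; proj₂)
open import Data.Sum as Sum using (_⊎_; inj₁; inj₂)
open import Data.Unit using (⊤; tt)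
open import Data.Vec using (Vec; lookup) renaming ([] to []ᵛ; _∷_ to _∷ᵛ_)
import Data.Vec.Properties as Vec
open import Function using (_∘_; _∘′_; case_of_)
open import Function.Bundles using (mk⇔)
open import Relation.Binary.Definitions using (tri<; tri≈; tri>)
open import Relation.Binary.PropositionalEquality
open import Relation.Nullary using (¬_; Dec; yes; no; does)
open import Relation.Nullary.Decidable using (dec-true; dec-false)

open +-*-Solver using (solve; _:=_; con; _:+_; _:*_)
open ≡-Reasoning

-- Ballot sequences and the Catalan numbers

paths : ℕ → ℕ → ℕ
paths zero    b       = 1
paths (suc a) zero    = 1
paths (suc a) (suc b) = paths a (suc b) + paths (suc a) b

paths-comm : ∀ a b → paths a b ≡ paths b a
paths-comm zero    zero    = refl
paths-comm zero    (suc b) = refl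
paths-comm (suc a) zero    = refl
paths-comm (suc a) (suc b) = begin
  paths a (suc b) + paths (suc a) b ≡⟨ cong₂ _+_ (paths-comm a (suc b)) (paths-comm (suc a) b) ⟩
  paths (suc b) a + paths b (suc a) ≡⟨ +-comm (paths (suc b) a) _ ⟩
  paths b (suc a) + paths (suc b) a ∎

paths-1 : ∀ a → paths a 1 ≡ suc a
paths-1 zero    = refl
paths-1 (suc a) = trans (cong (_+ 1) (paths-1 a)) (+-comm (suc a) 1)

paths≡C : ∀ a b → paths a b ≡ (a + b) C b
paths≡C zero    b       = sym (nCn≡1 b)
paths≡C (suc a) zero    = refl
paths≡C (suc a) (suc b) = begin
  paths a (suc b) + paths (suc a) b     ≡⟨ cong₂ _+_ (paths≡C a (suc b)) (paths≡C (suc a) b) ⟩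
  n C suc b + (suc a + b) C b           ≡⟨ cong (λ z → n C suc b + z C b) (sym (+-suc a b)) ⟩
  n C suc b + n C b                     ≡⟨ +-comm (n C suc b) _ ⟩
  n C b + n C suc b                     ≡⟨ nCk+nC[k+1]≡[n+1]C[k+1] n b ⟩
  suc n C suc b                         ∎
  where
  n : ℕ
  n = a + suc b

paths-absorb : ∀ a b → suc b * paths a (suc b) ≡ suc a * paths (suc a) b
paths-absorb zero    b       = begin
  suc b * 1         ≡⟨ *-identityʳ (suc b) ⟩
  suc b             ≡⟨ sym (paths-1 b) ⟩
  paths b 1         ≡⟨ paths-comm b 1 ⟩
  paths 1 b         ≡⟨ sym (+-identityʳ _) ⟩
  1 * paths 1 b     ∎
paths-absorb (suc a) zero    = begin
  paths (suc a) 1 + 0 ≡⟨ +-identityʳ _ ⟩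
  paths (suc a) 1     ≡⟨ paths-1 (suc a) ⟩
  suc (suc a)         ≡⟨ sym (*-identityʳ _) ⟩
  suc (suc a) * 1     ∎
paths-absorb (suc a) (suc b) = begin
  suc (suc b) * (Z + X)             ≡⟨ *-distribˡ-+ (suc (suc b)) Z X ⟩
  suc (suc b) * Z + suc (suc b) * X ≡⟨ cong (_+ suc (suc b) * X) (paths-absorb a (suc b)) ⟩
  suc a * X + suc (suc b) * X       ≡⟨ shift a b X ⟩
  suc (suc a) * X + suc b * X       ≡⟨ cong (suc (suc a) * X +_) (paths-absorb (suc a) b) ⟩
  suc (suc a) * X + suc (suc a) * Y ≡⟨ sym (*-distribˡ-+ (suc (suc a)) X Y) ⟩
  suc (suc a) * (X + Y)             ∎
  where
  X Y Z : ℕ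
  X = paths (suc a) (suc b)
  Y = paths (suc (suc a)) b
  Z = paths a (suc (suc b))
  shift : ∀ a b X → suc a * X + suc (suc b) * X ≡ suc (suc a) * X + suc b * X
  shift = solve 3 (λ a b X → (con 1 :+ a) :* X :+ (con 2 :+ b) :* X
                           := (con 2 :+ a) :* X :+ (con 1 :+ b) :* X) refl

-- Sequences of e steps true and o steps false, most recent step first, such that at no
-- time more false than true steps have been taken.
ballotSeqs : ℕ → ℕ → List (List Bool)
ballotSeqs zero    zero    = [] ∷ []
ballotSeqs zero    (suc o) = []
ballotSeqs (suc e) zero    = map (true ∷_) (ballotSeqs e zero)
ballotSeqs (suc e) (suc o) = map (true ∷_) (ballotSeqs e (suc o))
  ++ (if does (o ≤? e) then map (false ∷_) (ballotSeqs (suc e) o) else [])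

ballot : ℕ → ℕ → ℕ
ballot e o = length (ballotSeqs e o)

ballotSeqs-empty : ∀ {e o} → e < o → ballotSeqs e o ≡ []
ballotSeqs-empty {zero}  {suc o} _         = refl
ballotSeqs-empty {suc e} {suc o} (s≤s e<o)
  rewrite ballotSeqs-empty {e} {suc o} (m≤n⇒m≤1+n e<o) | dec-false (o ≤? e) (<⇒≱ e<o) = refl

ballot-zero : ∀ e → ballot e 0 ≡ 1
ballot-zero zero    = refl
ballot-zero (suc e) = trans (length-map (true ∷_) (ballotSeqs e 0)) (ballot-zero e)

ballot-step : ∀ {e o} → o ≤ e → ballot (suc e) (suc o) ≡ ballot e (suc o) + ballot (suc e) o
ballot-step {e} {o} o≤e rewrite dec-true (o ≤? e) o≤e = begin
  length (map (true ∷_) T ++ map (false ∷_) F)          ≡⟨ length-++ (map (true ∷_) T) ⟩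
  length (map (true ∷_) T) + length (map (false ∷_) F)  ≡⟨ cong₂ _+_ (length-map _ T) (length-map _ F) ⟩
  length T + length F                                   ∎
  where
  T F : List (List Bool)
  T = ballotSeqs e (suc o)
  F = ballotSeqs (suc e) o

-- The reflection principle: ballot e (o + 1) = C(e+o+1, o+1) - C(e+o+1, o).
ballot-reflection : ∀ {e o} → o ≤ e → ballot e (suc o) + paths (suc e) o ≡ paths e (suc o)
ballot-reflection {zero}  {zero}  _  = refl
ballot-reflection {suc e} {o}     o≤ with m≤n⇒m<n∨m≡n o≤
... | inj₂ refl rewrite ballotSeqs-empty (≤-refl {suc (suc e)}) = paths-comm (suc (suc e)) (suc e)
ballot-reflection {suc e} {zero}  _ | inj₁ _ = cong (_+ 1) (begin
  ballot (suc e) 1              ≡⟨ ballot-step {e} z≤n ⟩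
  ballot e 1 + ballot (suc e) 0 ≡⟨ cong (ballot e 1 +_) (ballot-zero (suc e)) ⟩
  ballot e 1 + 1                ≡⟨ ballot-reflection {e} z≤n ⟩
  paths e 1                     ∎)
ballot-reflection {suc e} {suc o} _ | inj₁ (s≤s o<e) = begin
  ballot (suc e) (suc (suc o)) + (X + Y) ≡⟨ cong (_+ (X + Y)) (ballot-step o<e) ⟩
  (A + B) + (X + Y)                      ≡⟨ +-+-swap A B X Y ⟩
  (A + X) + (B + Y)                      ≡⟨ cong₂ _+_ (ballot-reflection o<e)
                                                      (ballot-reflection {suc e} (m≤n⇒m≤1+n (<⇒≤ o<e))) ⟩
  paths e (suc (suc o)) + paths (suc e) (suc o) ∎
  where
  A B X Y : ℕ
  A = ballot e (suc (suc o))
  B = ballot (suc e) (suc o)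
  X = paths (suc e) (suc o)
  Y = paths (suc (suc e)) o
  +-+-swap : ∀ a b x y → (a + b) + (x + y) ≡ (a + x) + (b + y)
  +-+-swap = solve 4 (λ a b x y → (a :+ b) :+ (x :+ y) := (a :+ x) :+ (b :+ y)) refl

ballot-catalan : ∀ k → suc k * ballot k k ≡ paths k k
ballot-catalan zero    = refl
ballot-catalan (suc j) = +-cancelˡ-≡ (K * X) _ _ (begin
  K * X + suc K * ballot K K ≡⟨ cong (_+ suc K * ballot K K) (paths-absorb K j) ⟩
  suc K * Y + suc K * ballot K K ≡⟨ sym (*-distribˡ-+ (suc K) Y _) ⟩
  suc K * (Y + ballot K K)   ≡⟨ cong (suc K *_) (trans (+-comm Y _) (ballot-reflection (n≤1+n j))) ⟩
  suc K * X                  ≡⟨ +-comm X (K * X) ⟩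
  K * X + X                  ∎)
  where
  K X Y : ℕ
  K = suc j
  X = paths K K
  Y = paths (suc K) j

∈-ballotSeqs-push : ∀ {e o p} → p ∈ ballotSeqs e o → true ∷ p ∈ ballotSeqs (suc e) o
∈-ballotSeqs-push {o = zero}  p∈ = ∈-map⁺ (true ∷_) p∈
∈-ballotSeqs-push {o = suc o} p∈ = ∈-++⁺ˡ (∈-map⁺ (true ∷_) p∈)

∈-ballotSeqs-pop : ∀ {e o p} → p ∈ ballotSeqs e o → o < e → false ∷ p ∈ ballotSeqs e (suc o)
∈-ballotSeqs-pop {suc e} {o} p∈ (s≤s o≤e) rewrite dec-true (o ≤? e) o≤e =
  ∈-++⁺ʳ (map (true ∷_) (ballotSeqs e (suc o))) (∈-map⁺ (false ∷_) p∈)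

length-∈-ballotSeqs : ∀ e o {p} → p ∈ ballotSeqs e o → length p ≡ e + o
length-∈-ballotSeqs zero    zero    (here refl) = refl
length-∈-ballotSeqs (suc e) zero    p∈ with ∈-map⁻ _ p∈
... | p′ , p′∈ , refl = cong suc (length-∈-ballotSeqs e zero p′∈)
length-∈-ballotSeqs (suc e) (suc o) p∈ with ∈-++⁻ (map (true ∷_) (ballotSeqs e (suc o))) p∈
... | inj₁ p∈push with ∈-map⁻ _ p∈push
...   | p′ , p′∈ , refl = cong suc (length-∈-ballotSeqs e (suc o) p′∈)
length-∈-ballotSeqs (suc e) (suc o) p∈ | inj₂ p∈pop with o ≤? e
... | no o≰e rewrite dec-false (o ≤? e) o≰e = ⊥-elim (case p∈pop of λ ())
... | yes o≤e rewrite dec-true (o ≤? e) o≤e with ∈-map⁻ _ p∈pop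
...   | p′ , p′∈ , refl = cong suc (trans (length-∈-ballotSeqs (suc e) o p′∈) (sym (+-suc e o)))

ballotSeqs-unique : ∀ e o → Unique (ballotSeqs e o)
ballotSeqs-unique zero    zero    = [] ∷ []
ballotSeqs-unique zero    (suc o) = []
ballotSeqs-unique (suc e) zero    = Unique.map⁺ ∷-injectiveʳ (ballotSeqs-unique e zero)
ballotSeqs-unique (suc e) (suc o) with o ≤? e
... | no o≰e rewrite dec-false (o ≤? e) o≰e =
  Unique.++⁺ (Unique.map⁺ ∷-injectiveʳ (ballotSeqs-unique e (suc o))) [] λ ()
... | yes o≤e rewrite dec-true (o ≤? e) o≤e =
  Unique.++⁺ (Unique.map⁺ ∷-injectiveʳ (ballotSeqs-unique e (suc o)))
             (Unique.map⁺ ∷-injectiveʳ (ballotSeqs-unique (suc e) o)) disjoint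
  where
  disjoint : ∀ {v} → ¬ (v ∈ map (true ∷_) (ballotSeqs e (suc o))
                       × v ∈ map (false ∷_) (ballotSeqs (suc e) o))
  disjoint (v∈ , v∈′) with ∈-map⁻ _ v∈ | ∈-map⁻ _ v∈′
  ... | _ , _ , refl | _ , _ , ()

even-2* : ∀ h → Even (2 * h)
even-2* h = m∣m*n h

odd-1+2* : ∀ h → Odd (suc (2 * h))
odd-1+2* h (divides q eq) = even≢odd q h (trans (*-comm 2 q) (sym eq))

even⊎odd : ∀ n → (∃ λ h → n ≡ 2 * h) ⊎ (∃ λ h → n ≡ suc (2 * h))
even⊎odd zero    = inj₁ (0 , refl)
even⊎odd (suc n) with even⊎odd n
... | inj₁ (h , refl) = inj₂ (h , refl)
... | inj₂ (h , refl) = inj₁ (suc h , sym (*-suc 2 h))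

2*[1+k]≡2+k+k : ∀ k → 2 * suc k ≡ 2 + (k + k)
2*[1+k]≡2+k+k k = trans (*-suc 2 k) (cong (λ z → 2 + (k + z)) (+-identityʳ k))

1+2*<2* : ∀ {h r} → h < r → suc (2 * h) < 2 * r
1+2*<2* {h} {r} h<r = subst (_≤ 2 * r) (*-suc 2 h) (*-monoʳ-≤ 2 h<r)

-- Dumont and 213-avoiding lists of values

DumontList : List ℕ → Set
DumontList []          = ⊤
DumontList (x ∷ [])    = Odd x
DumontList (x ∷ y ∷ w) = (Even x → y < x) × (Odd x → x < y) × DumontList (y ∷ w)

Completes213 : ℕ → List ℕ → Set
Completes213 x []      = ⊥
Completes213 x (a ∷ w) = (a < x × ∃ λ c → c ∈ w × x < c) ⊎ Completes213 x w

Avoids213List : List ℕ → Set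
Avoids213List []      = ⊤
Avoids213List (x ∷ w) = ¬ Completes213 x w × Avoids213List w

StaysBelow : ℕ → List ℕ → Set
StaysBelow t []      = ⊤
StaysBelow t (x ∷ w) = (x < t → All (_< t) w) × StaysBelow t w

all<⇒¬Completes213 : ∀ {x w} → All (_< x) w → ¬ Completes213 x w
all<⇒¬Completes213 {w = _ ∷ _} (_ ∷ w<x) (inj₁ (_ , c , c∈w , x<c)) = <-asym x<c (All.lookup w<x c∈w)
all<⇒¬Completes213 {w = _ ∷ _} (_ ∷ w<x) (inj₂ x-w)               = all<⇒¬Completes213 w<x x-w

all<⇒StaysBelow : ∀ {t w} → All (_< t) w → StaysBelow t w
all<⇒StaysBelow []          = tt
all<⇒StaysBelow (_ ∷ w<t)   = (λ _ → w<t) , all<⇒StaysBelow w<t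

StaysBelow⇒≤head : ∀ {t y w} → StaysBelow t (y ∷ w) → t ∈ y ∷ w → t ≤ y
StaysBelow⇒≤head {t} {y} (below , _) t∈ with t ≤? y
... | yes t≤y = t≤y
... | no t≰y with t∈
...   | here refl  = ⊥-elim (t≰y ≤-refl)
...   | there t∈w = ⊥-elim (<-irrefl refl (All.lookup (below (≰⇒> t≰y)) t∈w))

StaysBelow⇒¬Completes213 : ∀ {x w} → StaysBelow (suc x) w → ¬ Completes213 x w
StaysBelow⇒¬Completes213 {w = _ ∷ _} (below , _) (inj₁ (a<x , c , c∈w , x<c)) =
  <-irrefl refl (<-≤-trans x<c (s≤s⁻¹ (All.lookup (below (m<n⇒m<1+n a<x)) c∈w)))
StaysBelow⇒¬Completes213 {w = _ ∷ _} (_ , sb) (inj₂ x-w) = StaysBelow⇒¬Completes213 sb x-w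

DumontList-++⁻ʳ : ∀ pre {l} → DumontList (pre ++ l) → DumontList l
DumontList-++⁻ʳ []            d = d
DumontList-++⁻ʳ (_ ∷ [])      {[]}    _ = _
DumontList-++⁻ʳ (_ ∷ [])      {_ ∷ _} d = proj₂ (proj₂ d)
DumontList-++⁻ʳ (_ ∷ b ∷ pre) d = DumontList-++⁻ʳ (b ∷ pre) (proj₂ (proj₂ d))

Avoids213List-++⁻ʳ : ∀ pre {l} → Avoids213List (pre ++ l) → Avoids213List l
Avoids213List-++⁻ʳ []        av = av
Avoids213List-++⁻ʳ (_ ∷ pre) av = Avoids213List-++⁻ʳ pre (proj₂ av)

Unique-++⁻ʳ : ∀ (pre : List ℕ) {l} → Unique (pre ++ l) → Unique l
Unique-++⁻ʳ []        u       = u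
Unique-++⁻ʳ (_ ∷ pre) (_ ∷ u) = Unique-++⁻ʳ pre u

Completes213-++⁺ʳ : ∀ pre {x l} → Completes213 x l → Completes213 x (pre ++ l)
Completes213-++⁺ʳ []        c = c
Completes213-++⁺ʳ (_ ∷ pre) c = inj₂ (Completes213-++⁺ʳ pre c)

∈-++-∷⁻ : ∀ (pre : List ℕ) {a x l} → a ∈ pre ++ x ∷ l → a ≢ x → a ∉ l → a ∈ pre
∈-++-∷⁻ pre a∈ a≢x a∉l with ∈-++⁻ pre a∈
... | inj₁ a∈pre        = a∈pre
... | inj₂ (here a≡x)   = ⊥-elim (a≢x a≡x)
... | inj₂ (there a∈l)  = ⊥-elim (a∉l a∈l)

suffix-at : ∀ (pre : List ℕ) {a l} → a ∈ pre → ∃₂ λ front back → pre ++ l ≡ front ++ a ∷ back ++ l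
suffix-at pre {a} {l} a∈ with ∈-∃++ a∈
... | front , back , refl = front , back , ++-assoc front (a ∷ back) l

¬Completes213-prefix : ∀ pre {b l} → Avoids213List (pre ++ l) → b ∈ pre → ¬ Completes213 b l
¬Completes213-prefix pre {l = l} av b∈ c with suffix-at pre {l = l} b∈
... | front , back , eq =
  proj₁ (Avoids213List-++⁻ʳ front (subst Avoids213List eq av)) (Completes213-++⁺ʳ back c)

-- the letter right after a is smaller than a, so it is x or forms a 213 with a and x
even-before-larger : ∀ {a x l} → DumontList (a ∷ l) → Avoids213List (a ∷ l) → Even a → x ∈ l → a < x → ⊥
even-before-larger {l = y ∷ _} (down , _) _        even (here refl) a<y = <-asym a<y (down even)
even-before-larger {l = y ∷ _} (down , _) (¬c , _) even (there x∈) a<x =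
  ¬c (inj₁ (down even , _ , x∈ , a<x))

even-before-larger-in-prefix : ∀ pre {a x l} → DumontList (pre ++ l) → Avoids213List (pre ++ l) →
                               a ∈ pre → Even a → x ∈ l → a < x → ⊥
even-before-larger-in-prefix pre {l = l} d av a∈ even x∈ a<x with suffix-at pre {l = l} a∈
... | front , back , eq = even-before-larger
  (DumontList-++⁻ʳ front (subst DumontList eq d)) (Avoids213List-++⁻ʳ front (subst Avoids213List eq av))
  even (∈-++⁺ʳ back x∈) a<x

odd-ascent : ∀ {x v l} → DumontList (x ∷ l) → Odd x → v ∈ l → ∃ λ y → y ∈ l × x < y
odd-ascent {l = y ∷ _} (_ , up , _) odd _ = y , here refl , up odd

after-2 : ∀ {l} → DumontList (2 ∷ l) → Avoids213List (2 ∷ l) → Unique (2 ∷ l) → All (1 ≤_) l → l ≡ 1 ∷ []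
after-2 {[]}                last-even _  _ _         = ⊥-elim (last-even (even-2* 1))
after-2 {0 ∷ _}             _          _  _ (() ∷ _)
after-2 {suc (suc _) ∷ _}   (down , _) _  _ _         with down (even-2* 1)
... | s≤s (s≤s ())
after-2 {1 ∷ []}            _          _  _ _         = refl
after-2 {1 ∷ z ∷ _}         d          av ((_ ∷ 2≢z ∷ _) ∷ (1≢z ∷ _) ∷ _) (_ ∷ 1≤z ∷ _) =
  ⊥-elim (even-before-larger d av (even-2* 1) (there (here refl)) (≤∧≢⇒< (≤∧≢⇒< 1≤z 1≢z) 2≢z))

record D213List (m : ℕ) (w : List ℕ) : Set where
  field
    unique    : Unique w
    dumont    : DumontList w
    avoids    : Avoids213List w
    ∈⇒bounded : ∀ {v} → v ∈ w → 1 ≤ v × v ≤ m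
    bounded⇒∈ : ∀ {v} → 1 ≤ v → v ≤ m → v ∈ w

ends-in-21 : ∀ {m w} → 2 ≤ m → D213List m w → ∃ λ u → w ≡ u ++ 2 ∷ 1 ∷ []
ends-in-21 {m} {w} 2≤m V with ∈-∃++ (D213List.bounded⇒∈ V (s≤s z≤n) 2≤m)
... | front , back , refl = front , cong (λ l → front ++ 2 ∷ l) (after-2
  (DumontList-++⁻ʳ front V.dumont) (Avoids213List-++⁻ʳ front V.avoids) (Unique-++⁻ʳ front V.unique)
  (All.tabulate (λ v∈ → proj₁ (V.∈⇒bounded (∈-++⁺ʳ front (there v∈))))))
  where module V = D213List V

-- Building a permutation from right to left

record State : Set where
  constructor state
  field
    half    : ℕ
    pending : List ℕ
    word    : List ℕ
open State

-- junk value on an empty stack, which never occurs along a ballot sequence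
top : List ℕ → ℕ
top []      = 0
top (h ∷ _) = h

push : State → State
push (state r hs w) = state (suc r) (r ∷ hs) (2 * suc r ∷ w)

pop : State → State
pop (state r hs w) = state r (drop 1 hs) (suc (2 * top hs) ∷ w)

run : List Bool → State
run []          = state 1 [] (2 ∷ 1 ∷ [])
run (true ∷ p)  = push (run p)
run (false ∷ p) = pop (run p)

length-word-run : ∀ p → length (word (run p)) ≡ 2 + length p
length-word-run []          = refl
length-word-run (true ∷ p)  = cong suc (length-word-run p)
length-word-run (false ∷ p) = cong suc (length-word-run p)

word-run-push≢pop : ∀ p q → word (run (true ∷ p)) ≢ word (run (false ∷ q))
word-run-push≢pop p q eq = even≢odd (suc (half (run p))) (top (pending (run q))) (∷-injectiveˡ eq)

word-run-injective : ∀ {p q} → word (run p) ≡ word (run q) → p ≡ q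
word-run-injective {[]}        {[]}        _  = refl
word-run-injective {[]}        {b ∷ q}     eq = case trans (cong length eq) (length-word-run (b ∷ q)) of λ ()
word-run-injective {b ∷ p}     {[]}        eq = case trans (cong length (sym eq)) (length-word-run (b ∷ p)) of λ ()
word-run-injective {true ∷ p}  {true ∷ q}  eq = cong (true ∷_) (word-run-injective (∷-injectiveʳ eq))
word-run-injective {false ∷ p} {false ∷ q} eq = cong (false ∷_) (word-run-injective (∷-injectiveʳ eq))
word-run-injective {true ∷ p}  {false ∷ q} eq = ⊥-elim (word-run-push≢pop p q eq)
word-run-injective {false ∷ p} {true ∷ q}  eq = ⊥-elim (word-run-push≢pop q p (sym eq))

Pending : ℕ → List ℕ → Set
Pending v hs = Any (λ h → v ≡ suc (2 * h)) hs

¬Pending-2* : ∀ a hs → ¬ Pending (2 * a) hs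
¬Pending-2* a (h ∷ _)  (here eq)  = even≢odd a h eq
¬Pending-2* a (_ ∷ hs) (there p)  = ¬Pending-2* a hs p

¬Pending-above : ∀ {h hs} → All (_< h) hs → ¬ Pending (suc (2 * h)) hs
¬Pending-above (h′<h ∷ _) (here eq) =
  <-irrefl (sym (*-cancelˡ-≡ _ _ 2 (suc-injective eq))) h′<h
¬Pending-above (_ ∷ hs<h) (there p) = ¬Pending-above hs<h p

record Invariant (e o : ℕ) (s : State) : Set where
  field
    half≡        : half s ≡ suc e
    pops         : length (pending s) + o ≡ e
    pending<half : All (_< half s) (pending s)
    pending-desc : AllPairs _>_ (pending s)
    ∈⇒bounded    : ∀ {v} → v ∈ word s → 1 ≤ v × v ≤ 2 * half s
    ∈⇒¬pending   : ∀ {v} → v ∈ word s → ¬ Pending v (pending s)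
    bounded⇒∈    : ∀ {v} → 1 ≤ v → v ≤ 2 * half s → ¬ Pending v (pending s) → v ∈ word s
    unique       : Unique (word s)
    dumont       : DumontList (word s)
    avoids       : Avoids213List (word s)
    -- so that placing a pending 2h+1 in front cannot make it the 2 of a 213
    staysBelow   : All (λ h → StaysBelow (2 * suc h) (word s)) (pending s)

2*half∈word : ∀ {e o s} → Invariant e o s → 2 * half s ∈ word s
2*half∈word {s = s} I = I.bounded⇒∈ (subst (λ r → 1 ≤ 2 * r) (sym I.half≡) (s≤s z≤n)) ≤-refl
                                    (¬Pending-2* (half s) (pending s))
  where module I = Invariant I

invariant-start : Invariant 0 0 (run [])
invariant-start = record
  { half≡ = refl ; pops = refl ; pending<half = [] ; pending-desc = []
  ; ∈⇒bounded = bounded ; ∈⇒¬pending = λ _ () ; bounded⇒∈ = ∈21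
  ; unique = ((λ ()) ∷ []) ∷ [] ∷ []
  ; dumont = (λ _ → s≤s (s≤s z≤n)) , (λ odd → ⊥-elim (odd (even-2* 1))) , odd-1+2* 0
  ; avoids = (λ { (inj₁ (_ , _ , () , _)) ; (inj₂ ()) }) , (λ ()) , tt
  ; staysBelow = [] }
  where
  bounded : ∀ {v} → v ∈ 2 ∷ 1 ∷ [] → 1 ≤ v × v ≤ 2
  bounded (here refl)         = s≤s z≤n , ≤-refl
  bounded (there (here refl)) = s≤s z≤n , s≤s z≤n
  ∈21 : ∀ {v} → 1 ≤ v → v ≤ 2 → ¬ Pending v [] → v ∈ 2 ∷ 1 ∷ []
  ∈21 {1} _ _ _ = there (here refl)
  ∈21 {2} _ _ _ = here refl
  ∈21 {suc (suc (suc _))} _ (s≤s (s≤s ())) _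

invariant-push : ∀ {e o s} → Invariant e o s → Invariant (suc e) o (push s)
invariant-push {e} {o} {state r hs w} I = record
  { half≡ = cong suc half≡
  ; pops = cong suc pops
  ; pending<half = ≤-refl ∷ All.map m<n⇒m<1+n pending<half
  ; pending-desc = pending<half ∷ pending-desc
  ; ∈⇒bounded = bounded
  ; ∈⇒¬pending = ¬pending
  ; bounded⇒∈ = bounded⇒∈′
  ; unique = All.tabulate (λ v∈ eq → <-irrefl (sym eq) (w<x v∈)) ∷ unique
  ; dumont = dumont′ (2*half∈word I) dumont (All.tabulate w<x)
  ; avoids = all<⇒¬Completes213 (All.tabulate w<x) , avoids
  ; staysBelow = ((λ x<x → ⊥-elim (<-irrefl refl x<x)) , all<⇒StaysBelow (All.tabulate w<x))
               ∷ All.map (λ {h} → belowOld {h}) (All.zip (pending<half , staysBelow))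
  }
  where
  open Invariant I
  x : ℕ
  x = 2 * suc r
  2r<x : 2 * r < x
  2r<x = *-monoʳ-< 2 (n<1+n r)
  w<x : ∀ {v} → v ∈ w → v < x
  w<x v∈ = ≤-<-trans (proj₂ (∈⇒bounded v∈)) 2r<x
  bounded : ∀ {v} → v ∈ x ∷ w → 1 ≤ v × v ≤ x
  bounded (here refl) = s≤s z≤n , ≤-refl
  bounded (there v∈)  = proj₁ (∈⇒bounded v∈) , <⇒≤ (w<x v∈)
  ¬pending : ∀ {v} → v ∈ x ∷ w → ¬ Pending v (r ∷ hs)
  ¬pending (here refl)        = ¬Pending-2* (suc r) (r ∷ hs)
  ¬pending (there v∈) (here eq)  = <-irrefl eq (s≤s (proj₂ (∈⇒bounded v∈)))
  ¬pending (there v∈) (there p)  = ∈⇒¬pending v∈ p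
  bounded⇒∈′ : ∀ {v} → 1 ≤ v → v ≤ x → ¬ Pending v (r ∷ hs) → v ∈ x ∷ w
  bounded⇒∈′ {v} 1≤v v≤x ¬p with v ≤? 2 * r | v ≟ suc (2 * r)
  ... | yes v≤2r | _      = there (bounded⇒∈ 1≤v v≤2r (¬p ∘′ there))
  ... | no _     | yes eq = ⊥-elim (¬p (here eq))
  ... | no v≰2r  | no v≢  = here (≤-antisym v≤x (subst (_≤ v) (sym (*-suc 2 r))
                                (≤∧≢⇒< (≰⇒> v≰2r) (v≢ ∘′ sym))))
  dumont′ : ∀ {w′} → 2 * r ∈ w′ → DumontList w′ → All (_< x) w′ → DumontList (x ∷ w′)
  dumont′ {_ ∷ _} _ d (y<x ∷ _) = (λ _ → y<x) , (λ odd → ⊥-elim (odd (even-2* (suc r)))) , d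
  belowOld : ∀ {h} → h < r × StaysBelow (2 * suc h) w → StaysBelow (2 * suc h) (x ∷ w)
  belowOld (h<r , sb) = (λ x<2h+2 → ⊥-elim (<-asym x<2h+2 (≤-<-trans (*-monoʳ-≤ 2 h<r) 2r<x))) , sb

invariant-pop : ∀ {e o} s → o < e → Invariant e o s → Invariant e (suc o) (pop s)
invariant-pop (state r []       w) o<e I = ⊥-elim (<-irrefl (Invariant.pops I) o<e)
invariant-pop {e} {o} (state r (h ∷ hs) w) _ I = record
  { half≡ = half≡
  ; pops = trans (+-suc (length hs) o) pops
  ; pending<half = All.tail pending<half
  ; pending-desc = AllPairs.tail pending-desc
  ; ∈⇒bounded = bounded
  ; ∈⇒¬pending = ¬pending
  ; bounded⇒∈ = bounded⇒∈′
  ; unique = All.tabulate (λ v∈ eq → ∈⇒¬pending v∈ (here (sym eq))) ∷ unique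
  ; dumont = dumont′ dumont (All.head staysBelow) 2h+2∈w
  ; avoids = StaysBelow⇒¬Completes213 (subst (λ t → StaysBelow t w) (*-suc 2 h) (All.head staysBelow))
           , avoids
  ; staysBelow = All.map belowOld (All.zip (AllPairs.head pending-desc , All.tail staysBelow))
  }
  where
  open Invariant I
  x : ℕ
  x = suc (2 * h)
  h<r : h < r
  h<r = All.head pending<half
  bounded : ∀ {v} → v ∈ x ∷ w → 1 ≤ v × v ≤ 2 * r
  bounded (here refl) = s≤s z≤n , <⇒≤ (1+2*<2* h<r)
  bounded (there v∈)  = ∈⇒bounded v∈
  ¬pending : ∀ {v} → v ∈ x ∷ w → ¬ Pending v hs
  ¬pending (here refl) = ¬Pending-above (AllPairs.head pending-desc)
  ¬pending (there v∈) p = ∈⇒¬pending v∈ (there p)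
  bounded⇒∈′ : ∀ {v} → 1 ≤ v → v ≤ 2 * r → ¬ Pending v hs → v ∈ x ∷ w
  bounded⇒∈′ {v} 1≤v v≤2r ¬p with v ≟ x
  ... | yes refl = here refl
  ... | no v≢x   = there (bounded⇒∈ 1≤v v≤2r λ { (here eq) → v≢x eq ; (there p) → ¬p p })
  2h+2∈w : 2 * suc h ∈ w
  2h+2∈w = bounded⇒∈ (s≤s z≤n) (*-monoʳ-≤ 2 h<r) (¬Pending-2* (suc h) (h ∷ hs))
  dumont′ : ∀ {w′} → DumontList w′ → StaysBelow (2 * suc h) w′ → 2 * suc h ∈ w′ → DumontList (x ∷ w′)
  dumont′ {_ ∷ _} d sb 2h+2∈ = (λ even → ⊥-elim (odd-1+2* h even))
    , (λ _ → <-≤-trans (subst (x <_) (sym (*-suc 2 h)) (n<1+n x)) (StaysBelow⇒≤head sb 2h+2∈)) , d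
  belowOld : ∀ {h′} → h′ < h × StaysBelow (2 * suc h′) w → StaysBelow (2 * suc h′) (x ∷ w)
  belowOld (h′<h , sb) =
    (λ x<2h′+2 → ⊥-elim (<-asym x<2h′+2 (≤-<-trans (*-monoʳ-≤ 2 h′<h) (n<1+n (2 * h))))) , sb

invariant-run : ∀ e o → All (λ p → Invariant e o (run p)) (ballotSeqs e o)

invariant-run-push : ∀ e o → All (λ p → Invariant (suc e) o (run p)) (map (true ∷_) (ballotSeqs e o))
invariant-run-push e o = All.map⁺ (All.map invariant-push (invariant-run e o))

invariant-run zero    zero    = invariant-start ∷ []
invariant-run zero    (suc o) = []
invariant-run (suc e) zero    = invariant-run-push e zero
invariant-run (suc e) (suc o) with o ≤? e
... | no o≰e rewrite dec-false (o ≤? e) o≰e = All.++⁺ (invariant-run-push e (suc o)) []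
... | yes o≤e rewrite dec-true (o ≤? e) o≤e = All.++⁺ (invariant-run-push e (suc o))
  (All.map⁺ (All.map (λ {p} → invariant-pop (run p) (s≤s o≤e)) (invariant-run (suc e) o)))

module _ {k p} (p∈ : p ∈ ballotSeqs k k) where
  private
    module I = Invariant (All.lookup (invariant-run k k) p∈)

    2*half≡2*suc : 2 * half (run p) ≡ 2 * suc k
    2*half≡2*suc = cong (2 *_) I.half≡

    ¬pending : ∀ {v} → ¬ Pending v (pending (run p))
    ¬pending with pending (run p) | I.pops
    ... | []    | _ = λ ()
    ... | _ ∷ _ | pops = ⊥-elim (<-irrefl (sym pops) (s≤s (m≤n+m k _)))

  D213List-run : D213List (2 * suc k) (word (run p))
  D213List-run = record
    { unique = I.unique ; dumont = I.dumont ; avoids = I.avoids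
    ; ∈⇒bounded = λ {v} v∈ → proj₁ (I.∈⇒bounded v∈) , subst (v ≤_) 2*half≡2*suc (proj₂ (I.∈⇒bounded v∈))
    ; bounded⇒∈ = λ {v} 1≤v v≤m → I.bounded⇒∈ 1≤v (subst (v ≤_) (sym 2*half≡2*suc) v≤m) ¬pending
    }

-- Every permutation in 𝔇¹(213) is built this way

module _ {m e o pre x} {s : State} (V : D213List m (pre ++ x ∷ word s)) (I : Invariant e o s) where
  private
    module V = D213List V
    module I = Invariant I

    x∈ : x ∈ pre ++ x ∷ word s
    x∈ = ∈-++⁺ʳ pre (here refl)

    x∉word : x ∉ word s
    x∉word = Unique.Unique[x∷xs]⇒x∉xs (Unique-++⁻ʳ pre V.unique)

    in-prefix : ∀ {a} → a ≤ m → 1 ≤ a → a ≢ x → a ∉ word s → a ∈ pre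
    in-prefix a≤m 1≤a = ∈-++-∷⁻ pre (V.bounded⇒∈ 1≤a a≤m)

    2*half≤m : 2 * half s ≤ m
    2*half≤m = proj₂ (V.∈⇒bounded (∈-++⁺ʳ pre (there (2*half∈word I))))

  next-even : Even x → x ≡ 2 * suc (half s)
  next-even even with even⊎odd x
  ... | inj₂ (h , refl) = ⊥-elim (odd-1+2* h even)
  ... | inj₁ (h , refl) with <-cmp h (suc (half s))
  ...   | tri≈ _ h≡ _ = cong (2 *_) h≡
  ...   | tri< h≤r _ _ = ⊥-elim (x∉word (I.bounded⇒∈ (proj₁ (V.∈⇒bounded x∈)) (*-monoʳ-≤ 2 (s≤s⁻¹ h≤r))
                                                       (¬Pending-2* h (pending s))))
  ...   | tri> _ _ r<h = ⊥-elim (even-before-larger-in-prefix pre V.dumont V.avoids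
                                       a∈pre (even-2* (suc (half s))) (here refl) a<x)
    where
    a<x : 2 * suc (half s) < 2 * h
    a<x = *-monoʳ-< 2 r<h
    a∉word : 2 * suc (half s) ∉ word s
    a∉word a∈ = <⇒≱ (*-monoʳ-< 2 (n<1+n (half s))) (proj₂ (I.∈⇒bounded a∈))
    a∈pre : 2 * suc (half s) ∈ pre
    a∈pre = in-prefix (≤-trans (<⇒≤ a<x) (proj₂ (V.∈⇒bounded x∈))) (s≤s z≤n) (<⇒≢ a<x) a∉word

  private
    x<2*half : Odd x → x < 2 * half s
    x<2*half odd with odd-ascent (DumontList-++⁻ʳ pre V.dumont) odd (2*half∈word I)
    ... | y , y∈ , x<y = <-≤-trans x<y (proj₂ (I.∈⇒bounded y∈))

    x-pending : Odd x → Pending x (pending s)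
    x-pending odd with Any.any? (λ h → x ≟ suc (2 * h)) (pending s)
    ... | yes p = p
    ... | no ¬p = ⊥-elim (x∉word (I.bounded⇒∈ (proj₁ (V.∈⇒bounded x∈)) (<⇒≤ (x<2*half odd)) ¬p))

    Pending⇒< : ∀ {h hs} → All (_< h) hs → Pending x hs → x < suc (2 * h)
    Pending⇒< (h′<h ∷ _)  (here refl) = s≤s (*-monoʳ-< 2 h′<h)
    Pending⇒< (_ ∷ hs<h) (there p)   = Pending⇒< hs<h p

  next-odd : Odd x → ∃₂ λ h hs → pending s ≡ h ∷ hs × x ≡ suc (2 * h)
  next-odd odd = top-pending (pending s) refl (x-pending odd)
    where
    top-pending : ∀ ps → ps ≡ pending s → Pending x ps → ∃₂ λ h hs → pending s ≡ h ∷ hs × x ≡ suc (2 * h)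
    top-pending (h ∷ hs) eq (here x≡) = h , hs , sym eq , x≡
    -- otherwise 2h+1 lies left of x and 2h+2 right of it: a 213
    top-pending (h ∷ hs) refl (there p) = ⊥-elim (¬Completes213-prefix pre V.avoids b∈pre
      (inj₁ (x<b , 2 * suc h , 2h+2∈ , subst (b <_) (sym (*-suc 2 h)) (n<1+n b))))
      where
      b : ℕ
      b = suc (2 * h)
      x<b : x < b
      x<b = Pending⇒< (AllPairs.head I.pending-desc) p
      h<half : h < half s
      h<half = All.head I.pending<half
      b∈pre : b ∈ pre
      b∈pre = in-prefix (≤-trans (<⇒≤ (1+2*<2* h<half)) 2*half≤m) (s≤s z≤n) (>⇒≢ x<b)
                        (λ b∈ → I.∈⇒¬pending b∈ (here refl))
      2h+2∈ : 2 * suc h ∈ word s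
      2h+2∈ = I.bounded⇒∈ (s≤s z≤n) (*-monoʳ-≤ 2 h<half) (¬Pending-2* (suc h) (pending s))

Reachable : List ℕ → Set
Reachable l = ∃₂ λ e o → ∃ λ p → p ∈ ballotSeqs e o × word (run p) ≡ l

reachable-∷ : ∀ {m e o p pre x} → p ∈ ballotSeqs e o → D213List m (pre ++ x ∷ word (run p)) →
              Reachable (x ∷ word (run p))
reachable-∷ {e = e} {o} {p} {x = x} p∈ V = step (2 ∣? x)
  where
  I : Invariant e o (run p)
  I = All.lookup (invariant-run e o) p∈
  step : Dec (Even x) → Reachable (x ∷ word (run p))
  step (yes even) = suc e , o , true ∷ p , ∈-ballotSeqs-push {e} {o} p∈ ,
    cong (_∷ _) (sym (next-even V I even))
  step (no odd) with next-odd V I odd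
  ... | h , hs , pending≡ , x≡ = e , suc o , false ∷ p , ∈-ballotSeqs-pop {e} {o} p∈ o<e ,
    cong (_∷ _) (trans (cong (λ ps → suc (2 * top ps)) pending≡) (sym x≡))
    where
    o<e : o < e
    o<e = subst (o <_) (Invariant.pops I)
            (subst (λ ps → o < length ps + o) (sym pending≡) (s≤s (m≤n+m o (length hs))))

suffix-reachable : ∀ {m} s pre → D213List m (pre ++ s ++ 2 ∷ 1 ∷ []) → Reachable (s ++ 2 ∷ 1 ∷ [])
suffix-reachable []      pre V = 0 , 0 , [] , here refl , refl
suffix-reachable {m} (x ∷ s) pre V
  with suffix-reachable s (pre ++ x ∷ []) (subst (D213List m) (sym (++-assoc pre (x ∷ []) _)) V)
... | e , o , p , p∈ , word≡ = subst (λ l → Reachable (x ∷ l)) word≡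
  (reachable-∷ {e = e} {o} p∈ (subst (λ l → D213List m (pre ++ x ∷ l)) (sym word≡) V))

module _ {e o m s} (I : Invariant e o s) (V : D213List m (word s)) where
  private
    module I = Invariant I
    module V = D213List V

    2*half≤m : 2 * half s ≤ m
    2*half≤m = proj₂ (V.∈⇒bounded (2*half∈word I))

  2*half≡m : 1 ≤ m → 2 * half s ≡ m
  2*half≡m 1≤m = ≤-antisym 2*half≤m (proj₂ (I.∈⇒bounded (V.bounded⇒∈ 1≤m ≤-refl)))

  no-pending : pending s ≡ []
  no-pending with pending s | I.pending<half | I.∈⇒¬pending
  ... | []     | _           | _        = refl
  ... | h ∷ _  | h<half ∷ _  | ¬pending = ⊥-elim (¬pending (V.bounded⇒∈ (s≤s z≤n)
                                          (≤-trans (<⇒≤ (1+2*<2* h<half)) 2*half≤m)) (here refl))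

reachable : ∀ {k w} → D213List (2 * suc k) w → ∃ λ p → p ∈ ballotSeqs k k × word (run p) ≡ w
reachable {k} V with ends-in-21 (*-monoʳ-≤ 2 (s≤s z≤n)) V
... | u , refl with suffix-reachable u [] V
... | e , o , p , p∈ , word≡ = p , subst₂ (λ e o → p ∈ ballotSeqs e o) e≡k (trans o≡e e≡k) p∈ , word≡
  where
  I : Invariant e o (run p)
  I = All.lookup (invariant-run e o) p∈
  V′ : D213List (2 * suc k) (word (run p))
  V′ = subst (D213List (2 * suc k)) (sym word≡) V
  e≡k : e ≡ k
  e≡k = suc-injective (trans (sym (Invariant.half≡ I)) (*-cancelˡ-≡ _ _ 2 (2*half≡m I V′ (s≤s z≤n))))
  o≡e : o ≡ e
  o≡e = trans (cong (λ ps → length ps + o) (sym (no-pending I V′))) (Invariant.pops I)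

-- Words over Fin m as lists of values

values : ∀ {m k} → Vec (Fin m) k → List ℕ
values []ᵛ       = []
values (x ∷ᵛ v) = suc (toℕ x) ∷ values v

∈-values⁺ : ∀ {m k} (v : Vec (Fin m) k) i → suc (toℕ (lookup v i)) ∈ values v
∈-values⁺ (x ∷ᵛ v) fzero    = here refl
∈-values⁺ (x ∷ᵛ v) (fsuc i) = there (∈-values⁺ v i)

∈-values⁻ : ∀ {m k} (v : Vec (Fin m) k) {y} → y ∈ values v → ∃ λ i → y ≡ suc (toℕ (lookup v i))
∈-values⁻ (x ∷ᵛ v) (here eq) = fzero , eq
∈-values⁻ (x ∷ᵛ v) (there y∈) with ∈-values⁻ v y∈
... | i , eq = fsuc i , eq

values-injective : ∀ {m k} {u v : Vec (Fin m) k} → values u ≡ values v → u ≡ v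
values-injective {u = []ᵛ}     {[]ᵛ}     _  = refl
values-injective {u = x ∷ᵛ u} {y ∷ᵛ v} eq with ∷-injective eq
... | x≡y , u≡v = cong₂ _∷ᵛ_ (Fin.toℕ-injective (suc-injective x≡y)) (values-injective u≡v)

values-surjective : ∀ {m k} xs → length xs ≡ k → All (λ y → 1 ≤ y × y ≤ m) xs →
                    ∃ λ (v : Vec (Fin m) k) → values v ≡ xs
values-surjective []           refl []                    = []ᵛ , refl
values-surjective (0 ∷ xs)     refl ((() , _) ∷ _)
values-surjective (suc y ∷ xs) refl ((_ , y<m) ∷ bounded) with values-surjective xs refl bounded
... | v , eq = fromℕ< y<m ∷ᵛ v , cong₂ _∷_ (cong suc (Fin.toℕ-fromℕ< y<m)) eq

-- For k = m these are IsPerm, Dumont1 and Contains213; the general length makes induction possible.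
InjectiveWord : ∀ {m k} → Vec (Fin m) k → Set
InjectiveWord v = ∀ i j → lookup v i ≡ lookup v j → i ≡ j

StepTo : ∀ {m k} → (Fin m → Fin m → Set) → Vec (Fin m) k → Fin k → Fin m → Set
StepTo R v i a = ∃[ j ] (Next i j × R a (lookup v j))

DumontAt : ∀ {m k} → Vec (Fin m) k → Fin k → Set
DumontAt {m} {k} v i =
    (Even (suc (toℕ (lookup v i))) → StepTo _>ᶠ_ v i (lookup v i))
  × (Odd (suc (toℕ (lookup v i))) → (suc (toℕ i) ≡ k) ⊎ StepTo _<ᶠ_ v i (lookup v i))

DumontWord : ∀ {m k} → Vec (Fin m) k → Set
DumontWord v = ∀ i → DumontAt v i

Contains213Word : ∀ {m k} → Vec (Fin m) k → Set
Contains213Word v = ∃[ i ] ∃[ j ] ∃[ l ]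
  (i <ᶠ j × j <ᶠ l × lookup v j <ᶠ lookup v i × lookup v i <ᶠ lookup v l)

InjectiveWord⇒Unique : ∀ {m k} (v : Vec (Fin m) k) → InjectiveWord v → Unique (values v)
InjectiveWord⇒Unique []ᵛ       _   = []
InjectiveWord⇒Unique (x ∷ᵛ v) inj =
  All.tabulate x∉ ∷ InjectiveWord⇒Unique v (λ i j eq → Fin.suc-injective (inj (fsuc i) (fsuc j) eq))
  where
  x∉ : ∀ {y} → y ∈ values v → suc (toℕ x) ≢ y
  x∉ y∈ eq with ∈-values⁻ v y∈
  ... | j , refl with inj fzero (fsuc j) (Fin.toℕ-injective (suc-injective eq))
  ... | ()

Unique⇒InjectiveWord : ∀ {m k} (v : Vec (Fin m) k) → Unique (values v) → InjectiveWord v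
Unique⇒InjectiveWord (x ∷ᵛ v) _            fzero    fzero    _  = refl
Unique⇒InjectiveWord (x ∷ᵛ v) (x∉ ∷ _)     fzero    (fsuc j) eq =
  ⊥-elim (All.lookup x∉ (∈-values⁺ v j) (cong (suc ∘ toℕ) eq))
Unique⇒InjectiveWord (x ∷ᵛ v) (x∉ ∷ _)     (fsuc i) fzero    eq =
  ⊥-elim (All.lookup x∉ (∈-values⁺ v i) (cong (suc ∘ toℕ) (sym eq)))
Unique⇒InjectiveWord (x ∷ᵛ v) (_ ∷ unique) (fsuc i) (fsuc j) eq =
  cong fsuc (Unique⇒InjectiveWord v unique i j eq)

DumontAt-suc⁻ : ∀ {m k} {x} {v : Vec (Fin m) k} {i} → DumontAt (x ∷ᵛ v) (fsuc i) → DumontAt v i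
DumontAt-suc⁻ {x = x} {v} {i} (down , up) =
  (λ even → step⁻ _>ᶠ_ (down even)) , (λ odd → Sum.map suc-injective (step⁻ _<ᶠ_) (up odd))
  where
  step⁻ : ∀ R {a} → StepTo R (x ∷ᵛ v) (fsuc i) a → StepTo R v i a
  step⁻ _ (fsuc j , next , r) = j , suc-injective next , r

DumontAt-suc⁺ : ∀ {m k} {x} {v : Vec (Fin m) k} {i} → DumontAt v i → DumontAt (x ∷ᵛ v) (fsuc i)
DumontAt-suc⁺ {x = x} {v} {i} (down , up) =
  (λ even → step⁺ _>ᶠ_ (down even)) , (λ odd → Sum.map (cong suc) (step⁺ _<ᶠ_) (up odd))
  where
  step⁺ : ∀ R {a} → StepTo R v i a → StepTo R (x ∷ᵛ v) (fsuc i) a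
  step⁺ _ (j , next , r) = fsuc j , cong suc next , r

DumontWord⇒DumontList : ∀ {m k} (v : Vec (Fin m) k) → DumontWord v → DumontList (values v)
DumontWord⇒DumontList []ᵛ               _ = _
DumontWord⇒DumontList (x ∷ᵛ []ᵛ)        D even with proj₁ (D fzero) even
... | fzero , () , _
DumontWord⇒DumontList (x ∷ᵛ y ∷ᵛ v) D =
  down , up , DumontWord⇒DumontList (y ∷ᵛ v) (DumontAt-suc⁻ ∘ D ∘ fsuc)
  where
  down : Even (suc (toℕ x)) → suc (toℕ y) < suc (toℕ x)
  down even with proj₁ (D fzero) even
  ... | fsuc fzero , refl , y<x = s≤s y<x
  up : Odd (suc (toℕ x)) → suc (toℕ x) < suc (toℕ y)
  up odd with proj₂ (D fzero) odd
  ... | inj₂ (fsuc fzero , refl , x<y) = s≤s x<y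

DumontList⇒DumontWord : ∀ {m k} (v : Vec (Fin m) k) → DumontList (values v) → DumontWord v
DumontList⇒DumontWord (x ∷ᵛ []ᵛ)     odd             fzero    =
  (λ even → ⊥-elim (odd even)) , (λ _ → inj₁ refl)
DumontList⇒DumontWord (x ∷ᵛ y ∷ᵛ v) (down , up , _) fzero    =
  (λ even → fsuc fzero , refl , s≤s⁻¹ (down even)) , (λ odd → inj₂ (fsuc fzero , refl , s≤s⁻¹ (up odd)))
DumontList⇒DumontWord (x ∷ᵛ y ∷ᵛ v) (_ , _ , D)     (fsuc i) =
  DumontAt-suc⁺ (DumontList⇒DumontWord (y ∷ᵛ v) D i)

Completes213At : ∀ {m k} → Fin m → Vec (Fin m) k → Set
Completes213At x v = ∃[ j ] ∃[ l ] (j <ᶠ l × lookup v j <ᶠ x × x <ᶠ lookup v l)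

Completes213⇒At : ∀ {m k} (x : Fin m) (v : Vec (Fin m) k) →
                  Completes213 (suc (toℕ x)) (values v) → Completes213At x v
Completes213⇒At x (a ∷ᵛ v) (inj₁ (a<x , c , c∈ , x<c)) with ∈-values⁻ v c∈
... | l , refl = fzero , fsuc l , s≤s z≤n , s≤s⁻¹ a<x , s≤s⁻¹ x<c
Completes213⇒At x (a ∷ᵛ v) (inj₂ c) with Completes213⇒At x v c
... | j , l , j<l , a<x , x<c = fsuc j , fsuc l , s≤s j<l , a<x , x<c

At⇒Completes213 : ∀ {m k} (x : Fin m) (v : Vec (Fin m) k) →
                  Completes213At x v → Completes213 (suc (toℕ x)) (values v)
At⇒Completes213 x (a ∷ᵛ v) (fzero , fsuc l , _ , a<x , x<c) =
  inj₁ (s≤s a<x , _ , ∈-values⁺ v l , s≤s x<c)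
At⇒Completes213 x (a ∷ᵛ v) (fsuc j , fsuc l , s≤s j<l , a<x , x<c) =
  inj₂ (At⇒Completes213 x v (j , l , j<l , a<x , x<c))

Avoids213List⇒¬Contains213Word : ∀ {m k} (v : Vec (Fin m) k) →
                                 Avoids213List (values v) → ¬ Contains213Word v
Avoids213List⇒¬Contains213Word (x ∷ᵛ v) (¬c , _) (fzero , fsuc j , fsuc l , _ , s≤s j<l , a<x , x<c) =
  ¬c (At⇒Completes213 x v (j , l , j<l , a<x , x<c))
Avoids213List⇒¬Contains213Word (x ∷ᵛ v) (_ , av) (fsuc i , fsuc j , fsuc l , s≤s i<j , s≤s j<l , p) =
  Avoids213List⇒¬Contains213Word v av (i , j , l , i<j , j<l , p)

¬Contains213Word⇒Avoids213List : ∀ {m k} (v : Vec (Fin m) k) →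
                                 ¬ Contains213Word v → Avoids213List (values v)
¬Contains213Word⇒Avoids213List []ᵛ       _ = _
¬Contains213Word⇒Avoids213List (x ∷ᵛ v) ¬c = ¬head , ¬Contains213Word⇒Avoids213List v ¬tail
  where
  ¬head : ¬ Completes213 (suc (toℕ x)) (values v)
  ¬head c with Completes213⇒At x v c
  ... | j , l , j<l , a<x , x<c = ¬c (fzero , fsuc j , fsuc l , s≤s z≤n , s≤s j<l , a<x , x<c)
  ¬tail : ¬ Contains213Word v
  ¬tail (i , j , l , i<j , j<l , p) = ¬c (fsuc i , fsuc j , fsuc l , s≤s i<j , s≤s j<l , p)

injective⇒surjective : ∀ {m} (f : Fin m → Fin m) → (∀ i j → f i ≡ f j → i ≡ j) → ∀ y → ∃ λ i → f i ≡ y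
injective⇒surjective {suc m} f inj y with Fin.any? (λ i → f i Fin.≟ y)
... | yes hit = hit
... | no miss = ⊥-elim (<-irrefl refl (Fin.injective⇒≤ {f = λ i → punchOut (y≢f i)}
                  λ {i} {j} eq → inj i j (Fin.punchOut-injective (y≢f i) (y≢f j) eq)))
  where
  y≢f : ∀ i → y ≢ f i
  y≢f i eq = miss (i , sym eq)

InD1-213⇒D213List : ∀ {m} (π : Word m m) → InD1-213 π → D213List m (values π)
InD1-213⇒D213List {m} π (perm , dumont , avoids) = record
  { unique    = InjectiveWord⇒Unique π perm
  ; dumont    = DumontWord⇒DumontList π dumont
  ; avoids    = ¬Contains213Word⇒Avoids213List π avoids
  ; ∈⇒bounded = bounded
  ; bounded⇒∈ = onto
  }
  where
  bounded : ∀ {v} → v ∈ values π → 1 ≤ v × v ≤ m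
  bounded v∈ with ∈-values⁻ π v∈
  ... | i , refl = s≤s z≤n , Fin.toℕ<n (lookup π i)
  onto : ∀ {v} → 1 ≤ v → v ≤ m → v ∈ values π
  onto {suc v} _ v<m with injective⇒surjective (lookup π) perm (fromℕ< v<m)
  ... | i , πi≡v = subst (_∈ values π) (cong suc (trans (cong toℕ πi≡v) (Fin.toℕ-fromℕ< v<m))) (∈-values⁺ π i)

D213List⇒InD1-213 : ∀ {m} (π : Word m m) → D213List m (values π) → InD1-213 π
D213List⇒InD1-213 π V = Unique⇒InjectiveWord π V.unique
                      , DumontList⇒DumontWord π V.dumont
                      , Avoids213List⇒¬Contains213Word π V.avoids
  where module V = D213List V

-- Counting

concatMap-map≡cartesianProductWith : ∀ {A B C : Set} (f : A → B → C) xs ys →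
                                     concatMap (λ x → map (f x) ys) xs ≡ cartesianProductWith f xs ys
concatMap-map≡cartesianProductWith f []       ys = refl
concatMap-map≡cartesianProductWith f (x ∷ xs) ys =
  cong (map (f x) ys ++_) (concatMap-map≡cartesianProductWith f xs ys)

allWords≡ : ∀ m k → allWords m (suc k) ≡ cartesianProductWith _∷ᵛ_ (allFin m) (allWords m k)
allWords≡ m k = concatMap-map≡cartesianProductWith _∷ᵛ_ (allFin m) (allWords m k)

∈-allWords : ∀ {m k} (v : Vec (Fin m) k) → v ∈ allWords m k
∈-allWords []ᵛ               = here refl
∈-allWords {m} {suc k} (x ∷ᵛ v) =
  subst (_ ∈_) (sym (allWords≡ m k)) (∈-cartesianProductWith⁺ _∷ᵛ_ (∈-allFin x) (∈-allWords v))

allWords-unique : ∀ m k → Unique (allWords m k)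
allWords-unique m zero    = [] ∷ []
allWords-unique m (suc k) = subst Unique (sym (allWords≡ m k))
  (Unique.cartesianProductWith⁺ _∷ᵛ_ Vec.∷-injective (Unique.allFin⁺ m) (allWords-unique m k))

same-image⇒length-≡ : ∀ {A B C : Set} (xs : List A) (ys : List B) (f : A → C) (g : B → C) →
  Unique (map f xs) → Unique (map g ys) →
  (∀ {x} → x ∈ xs → ∃ λ y → y ∈ ys × g y ≡ f x) →
  (∀ {y} → y ∈ ys → ∃ λ x → x ∈ xs × f x ≡ g y) → length xs ≡ length ys
same-image⇒length-≡ xs ys f g f-unique g-unique f⊆g g⊆f = begin
  length xs         ≡⟨ sym (length-map f xs) ⟩
  length (map f xs) ≡⟨ ↭-length (∼bag⇒↭ (unique∧set⇒bag f-unique g-unique (mk⇔ to from))) ⟩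
  length (map g ys) ≡⟨ length-map g ys ⟩
  length ys         ∎
  where
  to : ∀ {c} → c ∈ map f xs → c ∈ map g ys
  to c∈ with ∈-map⁻ f c∈
  ... | x , x∈ , refl with f⊆g x∈
  ...   | y , y∈ , gy≡fx = subst (_∈ map g ys) gy≡fx (∈-map⁺ g y∈)
  from : ∀ {c} → c ∈ map g ys → c ∈ map f xs
  from c∈ with ∈-map⁻ g c∈
  ... | y , y∈ , refl with g⊆f y∈
  ...   | x , x∈ , fx≡gy = subst (_∈ map f xs) fx≡gy (∈-map⁺ f x∈)

module _ (k : ℕ) where
  private
    m : ℕ
    m = 2 * suc k
    D : List (Word m m)
    D = filter inD1-213? (allWords m m)

    D⇒ballot : ∀ {π} → π ∈ D → ∃ λ p → p ∈ ballotSeqs k k × word (run p) ≡ values π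
    D⇒ballot {π} π∈ =
      reachable (InD1-213⇒D213List π (proj₂ (∈-filter⁻ inD1-213? {xs = allWords m m} π∈)))

    ballot⇒D : ∀ {p} → p ∈ ballotSeqs k k → ∃ λ π → π ∈ D × values π ≡ word (run p)
    ballot⇒D {p} p∈ = π , ∈-filter⁺ inD1-213? (∈-allWords π) (D213List⇒InD1-213 π V′) , values≡
      where
      V : D213List m (word (run p))
      V = D213List-run p∈
      length≡ : length (word (run p)) ≡ m
      length≡ = begin
        length (word (run p)) ≡⟨ length-word-run p ⟩
        2 + length p          ≡⟨ cong (2 +_) (length-∈-ballotSeqs k k p∈) ⟩
        2 + (k + k)           ≡⟨ sym (2*[1+k]≡2+k+k k) ⟩
        m                     ∎
      lifted : ∃ λ (π : Word m m) → values π ≡ word (run p)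
      lifted = values-surjective (word (run p)) length≡ (All.tabulate (D213List.∈⇒bounded V))
      π : Word m m
      π = proj₁ lifted
      values≡ : values π ≡ word (run p)
      values≡ = proj₂ lifted
      V′ : D213List m (values π)
      V′ = subst (D213List m) (sym values≡) V

  countD1-213≡ballot : countD1-213 (2 * suc k) ≡ ballot k k
  countD1-213≡ballot = same-image⇒length-≡ D (ballotSeqs k k) values (word ∘ run)
    (Unique.map⁺ values-injective (Unique.filter⁺ inD1-213? (allWords-unique m m)))
    (Unique.map⁺ word-run-injective (ballotSeqs-unique k k))
    D⇒ballot ballot⇒D

theorem2p2 : (n : ℕ) → .{{_ : NonZero n}} →
    countD1-213 (2 * n) ≡ ((2 * n ∸ 2) C (n ∸ 1)) / n
theorem2p2 (suc k) = begin
  countD1-213 (2 * suc k)            ≡⟨ countD1-213≡ballot k ⟩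
  ballot k k                         ≡⟨ sym (m*n/n≡m (ballot k k) (suc k)) ⟩
  ballot k k * suc k / suc k         ≡⟨ cong (_/ suc k) (*-comm (ballot k k) (suc k)) ⟩
  suc k * ballot k k / suc k         ≡⟨ cong (_/ suc k) (ballot-catalan k) ⟩
  paths k k / suc k                  ≡⟨ cong (_/ suc k) (paths≡C k k) ⟩
  ((k + k) C k) / suc k              ≡⟨ cong (λ n → (n C k) / suc k) (sym 2*[1+k]∸2≡k+k) ⟩
  ((2 * suc k ∸ 2) C (suc k ∸ 1)) / suc k ∎
  where
  2*[1+k]∸2≡k+k : 2 * suc k ∸ 2 ≡ k + k
  2*[1+k]∸2≡k+k = cong (_∸ 2) (2*[1+k]≡2+k+k k)
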